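{- (1) For all $\varphi\in\mathcal{L}_{Par}$: if $\mathsf{G}\vdash\varphi^{nf}$ then $\mathsf{Par}\vdash\varphi$. (2) For all $\xi\in\mathcal{L}_{NF}$: if $\mathsf{G}\vdash\xi$ then $\mathsf{Par}\vdash\xi^{par}$.
   Context: Fix countable sets $\mathsf{P}_0$ (atomic propositions) and $\mathsf{G}_0$ (atomic games). Parikh's language: formulas $\mathcal{L}_{Par}$ and games $\mathcal{G}_{Par}$ given by $\varphi ::= p \mid \neg\varphi \mid \varphi\lor\varphi \mid \langle\gamma\rangle\varphi$, $\gamma ::= g \mid \gamma;\gamma \mid \gamma\sqcup\gamma \mid \gamma^* \mid \gamma^d \mid \varphi?$ ($\to,\land,\leftrightarrow$ abbreviations). Normal-form language: formulas $\mathcal{L}_{NF}$ and games $\mathcal{G}_{NF}$ given by $\varphi ::= p \mid \neg p \mid \varphi\lor\varphi \mid \varphi\land\varphi \mid \langle\gamma\rangle\varphi$, $\gamma ::= g \mid g^d \mid \gamma;\gamma \mid \gamma\sqcup\gamma \mid \gamma\sqcap\gamma \mid \gamma^* \mid \gamma^\times \mid \varphi? \mid \varphi!$. Translation $(\cdot)^{nf}:\mathcal{L}_{Par}\to\mathcal{L}_{NF}$ (dual and negation normal form), defined recursively: $p^{nf}=p$, $(\neg p)^{nf}=\neg p$, $(\neg\neg\varphi)^{nf}=\varphi^{nf}$, $(\varphi\lor\psi)^{nf}=\varphi^{nf}\lor\psi^{nf}$, $(\neg(\varphi\lor\psi))^{nf}=(\neg\varphi)^{nf}\land(\neg\psi)^{nf}$,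 $(\langle\gamma\rangle\varphi)^{nf}=\langle\gamma^{nf}\rangle\varphi^{nf}$, $(\neg\langle\gamma\rangle\varphi)^{nf}=\langle(\gamma^d)^{nf}\rangle(\neg\varphi)^{nf}$; on games $g^{nf}=g$, $(\gamma;\delta)^{nf}=\gamma^{nf};\delta^{nf}$, $(\gamma\sqcup\delta)^{nf}=\gamma^{nf}\sqcup\delta^{nf}$, $(\gamma^*)^{nf}=(\gamma^{nf})^*$, $(\varphi?)^{nf}=\varphi^{nf}?$, $(g^d)^{nf}=g^d$, $((\gamma^d)^d)^{nf}=\gamma^{nf}$, $((\gamma\sqcup\delta)^d)^{nf}=(\gamma^d)^{nf}\sqcap(\delta^d)^{nf}$, $((\gamma;\delta)^d)^{nf}=(\gamma^d)^{nf};(\delta^d)^{nf}$, $((\gamma^*)^d)^{nf}=((\gamma^d)^{nf})^\times$, $((\varphi?)^d)^{nf}=(\neg\varphi)^{nf}!$. Translation $(\cdot)^{par}:\mathcal{L}_{NF}\to\mathcal{L}_{Par}$: $p^{par}=p$, $(\neg p)^{par}=\neg p$, $(\varphi\lor\psi)^{par}=\varphi^{par}\lor\psi^{par}$, $(\varphi\land\psi)^{par}=\neg(\neg\varphi^{par}\lor\neg\psi^{par})$, $(\langle\gamma\rangle\varphi)^{par}=\langle\gamma^{par}\rangle\varphi^{par}$; $g^{par}=g$, $(g^d)^{par}=g^d$, $(\gamma\sqcup\delta)^{par}=\gamma^{par}\sqcup\delta^{par}$, $(\gamma\sqcap\delta)^{par}=((\gamma^{par})^d\sqcup(\delta^{par})^d)^d$,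 $(\gamma;\delta)^{par}=\gamma^{par};\delta^{par}$, $(\gamma^*)^{par}=(\gamma^{par})^*$, $(\gamma^\times)^{par}=(((\gamma^{par})^d)^*)^d$, $(\varphi?)^{par}=\varphi^{par}?$, $(\varphi!)^{par}=((\neg\varphi^{par})?)^d$. $\mathsf{Par}$ is the Hilbert system over $\mathcal{L}_{Par}$ with axioms: propositional tautologies; $\langle\gamma;\delta\rangle\varphi\leftrightarrow\langle\gamma\rangle\langle\delta\rangle\varphi$; $\langle\gamma\sqcup\delta\rangle\varphi\leftrightarrow\langle\gamma\rangle\varphi\lor\langle\delta\rangle\varphi$; $\langle\gamma^*\rangle\varphi\leftrightarrow\varphi\lor\langle\gamma\rangle\langle\gamma^*\rangle\varphi$; $\langle\psi?\rangle\varphi\leftrightarrow\psi\land\varphi$; $\langle\gamma^d\rangle\varphi\leftrightarrow\neg\langle\gamma\rangle\neg\varphi$; rules modus ponens, monotonicity (from $\varphi\to\psi$ infer $\langle\gamma\rangle\varphi\to\langle\gamma\rangle\psi$), bar induction (from $\langle\gamma\rangle\varphi\to\varphi$ infer $\langle\gamma^*\rangle\varphi\to\varphi$). Complement on $\mathcal{L}_{NF}$: $\overline p=\neg p$, $\overline{\neg p}=p$, $\overline{\varphi\lor\psi}=\overline\varphi\land\overline\psi$, $\overline{\varphi\land\psi}=\overline\varphi\lor\overline\psi$, $\overline{\langle\gamma\rangle\varphi}=\langle\check\gamma\rangle\overline\varphi$, with $\check g=g^d$, $\check{(g^d)}=g$, $\check{(\gamma;\delta)}=\check\gamma;\check\delta$,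 $\check{(\gamma\sqcup\delta)}=\check\gamma\sqcap\check\delta$, $\check{(\gamma\sqcap\delta)}=\check\gamma\sqcup\check\delta$, $\check{(\gamma^*)}=(\check\gamma)^\times$, $\check{(\gamma^\times)}=(\check\gamma)^*$, $\check{(\varphi?)}=\overline\varphi!$, $\check{(\varphi!)}=\overline\varphi?$; for finite $\Phi=\{\varphi_1,\dots,\varphi_n\}$, $\overline\Phi:=\overline{\varphi_1}\land\dots\land\overline{\varphi_n}$. $\mathsf{G}$ is the sequent calculus on finite sets of $\mathcal{L}_{NF}$-formulas with rules: axiom $\Phi,\overline\Phi$; weakening $\Phi/\Phi,\varphi$; $\varphi,\psi/\langle g\rangle\varphi,\langle g^d\rangle\psi$; $\Phi,\varphi,\psi/\Phi,\varphi\lor\psi$; $\Phi,\varphi$ and $\Phi,\psi/\Phi,\varphi\land\psi$; $\Phi,\varphi\lor\langle\gamma\rangle\langle\gamma^*\rangle\varphi/\Phi,\langle\gamma^*\rangle\varphi$; $\Phi,\varphi\land\langle\gamma\rangle\langle\gamma^\times\rangle\varphi/\Phi,\langle\gamma^\times\rangle\varphi$; $\Phi,\langle\gamma\rangle\varphi\lor\langle\delta\rangle\varphi/\Phi,\langle\gamma\sqcup\delta\rangle\varphi$; $\Phi,\langle\gamma\rangle\varphi\land\langle\delta\rangle\varphi/\Phi,\langle\gamma\sqcap\delta\rangle\varphi$; $\Phi,\psi\land\varphi/\Phi,\langle\psi?\rangle\varphi$; $\Phi,\psi\lor\varphi/\Phi,\langle\psi!\rangle\varphi$; deep rules (for $\psi(\cdot)$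 a formula with a unique placeholder occurrence of formula or game sort): $\Phi,\psi(\gamma)/\Phi,\psi(\chi!;\gamma)$, $\Phi,\psi(\varphi)/\Phi,\psi(\langle\chi!\rangle\varphi)$, $\Phi,\psi(\langle\gamma\rangle\langle\delta\rangle\varphi)/\Phi,\psi(\langle\gamma;\delta\rangle\varphi)$; and $\Phi,\varphi\land\langle\gamma\rangle\langle(\overline\Phi!;\gamma)^\times\rangle\langle\overline\Phi!\rangle\varphi/\Phi,\langle\gamma^\times\rangle\varphi$. $\mathsf{G}\vdash\xi$: there is a finite derivation of $\{\xi\}$ with all leaves axioms. -}

module Defs where

open import Data.Nat using (ℕ)
open import Data.Bool using (Bool; true; false; not; _∨_)
open import Data.List using (List; []; _∷_)
open import Data.List.Membership.Propositional using (_∈_)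
open import Data.List.Relation.Unary.Unique.Propositional using (Unique)
open import Function.Bundles using (_⇔_)
open import Relation.Binary.PropositionalEquality using (_≡_)

-- Atomic propositions P₀ and atomic games G₀ : both countable, taken to be ℕ.

infixr 6 _∨ᵖ_
infixr 7 _⨟ᵖ_
infixr 6 _⊔ᵖ_

data Fm : Set
data Gm : Set

data Fm where
  atom : ℕ → Fm
  ¬ᵖ_  : Fm → Fm
  _∨ᵖ_ : Fm → Fm → Fm
  ⟨_⟩ᵖ_ : Gm → Fm → Fm

data Gm where
  gᵖ    : ℕ → Gm
  _⨟ᵖ_  : Gm → Gm → Gm
  _⊔ᵖ_  : Gm → Gm → Gm
  _*ᵖ   : Gm → Gm
  _ᵈᵖ   : Gm → Gm
  _?ᵖ   : Fm → Gm

_→ᵖ_ : Fm → Fm → Fm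
φ →ᵖ ψ = (¬ᵖ φ) ∨ᵖ ψ

_∧ᵖ_ : Fm → Fm → Fm
φ ∧ᵖ ψ = ¬ᵖ ((¬ᵖ φ) ∨ᵖ (¬ᵖ ψ))

_↔ᵖ_ : Fm → Fm → Fm
φ ↔ᵖ ψ = (φ →ᵖ ψ) ∧ᵖ (ψ →ᵖ φ)

infixr 6 _∨ⁿ_
infixr 6 _∧ⁿ_
infixr 7 _⨟ⁿ_
infixr 6 _⊔ⁿ_
infixr 6 _⊓ⁿ_

data NFm : Set
data NGm : Set

data NFm where
  pos  : ℕ → NFm
  neg  : ℕ → NFm
  _∨ⁿ_ : NFm → NFm → NFm
  _∧ⁿ_ : NFm → NFm → NFm
  ⟨_⟩ⁿ_ : NGm → NFm → NFm

data NGm where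
  gⁿ   : ℕ → NGm
  gdⁿ  : ℕ → NGm
  _⨟ⁿ_ : NGm → NGm → NGm
  _⊔ⁿ_ : NGm → NGm → NGm
  _⊓ⁿ_ : NGm → NGm → NGm
  _*ⁿ  : NGm → NGm
  _×ⁿ  : NGm → NGm
  _?ⁿ  : NFm → NGm
  _!ⁿ  : NFm → NGm

-- Translation (·)^nf.
--   nf φ     = φ^nf
--   nfNeg φ  = (¬ φ)^nf
--   nfG γ    = γ^nf
--   nfGd γ   = (γ^d)^nf
-- (the clauses below are exactly the recursive clauses of the paper,
--  organised so that recursion is structural)

nf    : Fm → NFm
nfNeg : Fm → NFm
nfG   : Gm → NGm
nfGd  : Gm → NGm

nf (atom p)   = pos p
nf (¬ᵖ φ)     = nfNeg φ
nf (φ ∨ᵖ ψ)   = nf φ ∨ⁿ nf ψ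
nf (⟨ γ ⟩ᵖ φ) = ⟨ nfG γ ⟩ⁿ nf φ

nfNeg (atom p)   = neg p
nfNeg (¬ᵖ φ)     = nf φ
nfNeg (φ ∨ᵖ ψ)   = nfNeg φ ∧ⁿ nfNeg ψ
nfNeg (⟨ γ ⟩ᵖ φ) = ⟨ nfGd γ ⟩ⁿ nfNeg φ

nfG (gᵖ g)     = gⁿ g
nfG (γ ⨟ᵖ δ)   = nfG γ ⨟ⁿ nfG δ
nfG (γ ⊔ᵖ δ)   = nfG γ ⊔ⁿ nfG δ
nfG (γ *ᵖ)     = (nfG γ) *ⁿ
nfG (γ ᵈᵖ)     = nfGd γ
nfG (φ ?ᵖ)     = (nf φ) ?ⁿ

nfGd (gᵖ g)    = gdⁿ g
nfGd (γ ⨟ᵖ δ)  = nfGd γ ⨟ⁿ nfGd δ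
nfGd (γ ⊔ᵖ δ)  = nfGd γ ⊓ⁿ nfGd δ
nfGd (γ *ᵖ)    = (nfGd γ) ×ⁿ
nfGd (γ ᵈᵖ)    = nfG γ
nfGd (φ ?ᵖ)    = (nfNeg φ) !ⁿ

par  : NFm → Fm
parG : NGm → Gm

par (pos p)      = atom p
par (neg p)      = ¬ᵖ (atom p)
par (φ ∨ⁿ ψ)     = par φ ∨ᵖ par ψ
par (φ ∧ⁿ ψ)     = ¬ᵖ ((¬ᵖ par φ) ∨ᵖ (¬ᵖ par ψ))
par (⟨ γ ⟩ⁿ φ)   = ⟨ parG γ ⟩ᵖ par φ

parG (gⁿ g)      = gᵖ g
parG (gdⁿ g)     = (gᵖ g) ᵈᵖ
parG (γ ⊔ⁿ δ)    = parG γ ⊔ᵖ parG δ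
parG (γ ⊓ⁿ δ)    = (((parG γ) ᵈᵖ) ⊔ᵖ ((parG δ) ᵈᵖ)) ᵈᵖ
parG (γ ⨟ⁿ δ)    = parG γ ⨟ᵖ parG δ
parG (γ *ⁿ)      = (parG γ) *ᵖ
parG (γ ×ⁿ)      = ((((parG γ) ᵈᵖ) *ᵖ) ᵈᵖ)
parG (φ ?ⁿ)      = (par φ) ?ᵖ
parG (φ !ⁿ)      = (((¬ᵖ (par φ)) ?ᵖ) ᵈᵖ)

-- Propositional tautologies over L_Par: formulas true under every
-- Boolean valuation of their propositional "atoms", where the
-- propositional atoms are the atomic propositions and the modal
-- formulas ⟨γ⟩φ (i.e. substitution instances of classical tautologies).

evalP : (Fm → Bool) → Fm → Bool
evalP v (atom p)   = v (atom p)
evalP v (¬ᵖ φ)     = not (evalP v φ)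
evalP v (φ ∨ᵖ ψ)   = evalP v φ ∨ evalP v ψ
evalP v (⟨ γ ⟩ᵖ φ) = v (⟨ γ ⟩ᵖ φ)

Tautology : Fm → Set
Tautology φ = (v : Fm → Bool) → evalP v φ ≡ true

data Par⊢_ : Fm → Set where
  taut   : ∀ {φ} → Tautology φ → Par⊢ φ
  ax-seq : ∀ γ δ φ → Par⊢ ((⟨ γ ⨟ᵖ δ ⟩ᵖ φ) ↔ᵖ (⟨ γ ⟩ᵖ ⟨ δ ⟩ᵖ φ))
  ax-cho : ∀ γ δ φ → Par⊢ ((⟨ γ ⊔ᵖ δ ⟩ᵖ φ) ↔ᵖ ((⟨ γ ⟩ᵖ φ) ∨ᵖ (⟨ δ ⟩ᵖ φ)))
  ax-itr : ∀ γ φ → Par⊢ ((⟨ γ *ᵖ ⟩ᵖ φ) ↔ᵖ (φ ∨ᵖ (⟨ γ ⟩ᵖ ⟨ γ *ᵖ ⟩ᵖ φ)))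
  ax-tst : ∀ ψ φ → Par⊢ ((⟨ ψ ?ᵖ ⟩ᵖ φ) ↔ᵖ (ψ ∧ᵖ φ))
  ax-dua : ∀ γ φ → Par⊢ ((⟨ γ ᵈᵖ ⟩ᵖ φ) ↔ᵖ (¬ᵖ (⟨ γ ⟩ᵖ (¬ᵖ φ))))
  mp     : ∀ {φ ψ} → Par⊢ (φ →ᵖ ψ) → Par⊢ φ → Par⊢ ψ
  mono   : ∀ {φ ψ} γ → Par⊢ (φ →ᵖ ψ) → Par⊢ ((⟨ γ ⟩ᵖ φ) →ᵖ (⟨ γ ⟩ᵖ ψ))
  barind : ∀ {φ γ} → Par⊢ ((⟨ γ ⟩ᵖ φ) →ᵖ φ) → Par⊢ ((⟨ γ *ᵖ ⟩ᵖ φ) →ᵖ φ)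

comp  : NFm → NFm
compG : NGm → NGm

comp (pos p)    = neg p
comp (neg p)    = pos p
comp (φ ∨ⁿ ψ)   = comp φ ∧ⁿ comp ψ
comp (φ ∧ⁿ ψ)   = comp φ ∨ⁿ comp ψ
comp (⟨ γ ⟩ⁿ φ) = ⟨ compG γ ⟩ⁿ comp φ

compG (gⁿ g)    = gdⁿ g
compG (gdⁿ g)   = gⁿ g
compG (γ ⨟ⁿ δ)  = compG γ ⨟ⁿ compG δ
compG (γ ⊔ⁿ δ)  = compG γ ⊓ⁿ compG δ
compG (γ ⊓ⁿ δ)  = compG γ ⊔ⁿ compG δ
compG (γ *ⁿ)    = (compG γ) ×ⁿ
compG (γ ×ⁿ)    = (compG γ) *ⁿ
compG (φ ?ⁿ)    = (comp φ) !ⁿ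
compG (φ !ⁿ)    = (comp φ) ?ⁿ

-- Complement of a nonempty finite set, enumerated as φ₁ ∷ [φ₂ … φₙ]:
--   compSet φ₁ [φ₂ … φₙ] = φ̄₁ ∧ (φ̄₂ ∧ ( … ∧ φ̄ₙ))
compSet : NFm → List NFm → NFm
compSet φ []       = comp φ
compSet φ (ψ ∷ Ψ)  = comp φ ∧ⁿ compSet ψ Ψ

data Sort : Set where
  fsort gsort : Sort

HoleT : Sort → Set
HoleT fsort = NFm
HoleT gsort = NGm

data FCtx : Sort → Set
data GCtx : Sort → Set

data FCtx where
  fhole : FCtx fsort
  ∨L   : ∀ {s} → FCtx s → NFm → FCtx s
  ∨R   : ∀ {s} → NFm → FCtx s → FCtx s
  ∧L   : ∀ {s} → FCtx s → NFm → FCtx s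
  ∧R   : ∀ {s} → NFm → FCtx s → FCtx s
  ⟨⟩G  : ∀ {s} → GCtx s → NFm → FCtx s
  ⟨⟩F  : ∀ {s} → NGm → FCtx s → FCtx s

data GCtx where
  ghole : GCtx gsort
  ⨟L   : ∀ {s} → GCtx s → NGm → GCtx s
  ⨟R   : ∀ {s} → NGm → GCtx s → GCtx s
  ⊔L   : ∀ {s} → GCtx s → NGm → GCtx s
  ⊔R   : ∀ {s} → NGm → GCtx s → GCtx s
  ⊓L   : ∀ {s} → GCtx s → NGm → GCtx s
  ⊓R   : ∀ {s} → NGm → GCtx s → GCtx s
  *C   : ∀ {s} → GCtx s → GCtx s
  ×C   : ∀ {s} → GCtx s → GCtx s
  ?C   : ∀ {s} → FCtx s → GCtx s
  !C   : ∀ {s} → FCtx s → GCtx s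

plugF : ∀ {s} → FCtx s → HoleT s → NFm
plugG : ∀ {s} → GCtx s → HoleT s → NGm

plugF fhole x       = x
plugF (∨L c ψ) x    = plugF c x ∨ⁿ ψ
plugF (∨R ψ c) x    = ψ ∨ⁿ plugF c x
plugF (∧L c ψ) x    = plugF c x ∧ⁿ ψ
plugF (∧R ψ c) x    = ψ ∧ⁿ plugF c x
plugF (⟨⟩G c ψ) x   = ⟨ plugG c x ⟩ⁿ ψ
plugF (⟨⟩F γ c) x   = ⟨ γ ⟩ⁿ plugF c x

plugG ghole x       = x
plugG (⨟L c δ) x    = plugG c x ⨟ⁿ δ
plugG (⨟R δ c) x    = δ ⨟ⁿ plugG c x
plugG (⊔L c δ) x    = plugG c x ⊔ⁿ δ
plugG (⊔R δ c) x    = δ ⊔ⁿ plugG c x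
plugG (⊓L c δ) x    = plugG c x ⊓ⁿ δ
plugG (⊓R δ c) x    = δ ⊓ⁿ plugG c x
plugG (*C c) x      = (plugG c x) *ⁿ
plugG (×C c) x      = (plugG c x) ×ⁿ
plugG (?C c) x      = (plugF c x) ?ⁿ
plugG (!C c) x      = (plugF c x) !ⁿ

-- Sequents are finite sets of L_NF-formulas, represented by lists taken
-- up to extensional (same-members) equality: rule `reorder` identifies
-- lists with the same members.  "Φ, φ" is  φ ∷ Φ.

SameSet : List NFm → List NFm → Set
SameSet Γ Δ = ∀ x → (x ∈ Γ) ⇔ (x ∈ Δ)

data G⊢_ : List NFm → Set where
  reorder : ∀ {Γ Δ} → G⊢ Γ → SameSet Γ Δ → G⊢ Δ
  -- axiom  Φ, Φ̄   (Φ = {φ₁,…,φₙ} nonempty, enumerated without repetition)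
  ax      : ∀ φ Φ → Unique (φ ∷ Φ) → G⊢ (compSet φ Φ ∷ φ ∷ Φ)
  weak    : ∀ {Φ φ} → G⊢ Φ → G⊢ (φ ∷ Φ)
  modal   : ∀ {φ ψ} g → G⊢ (φ ∷ ψ ∷ []) → G⊢ ((⟨ gⁿ g ⟩ⁿ φ) ∷ (⟨ gdⁿ g ⟩ⁿ ψ) ∷ [])
  ∨rule   : ∀ {Φ φ ψ} → G⊢ (φ ∷ ψ ∷ Φ) → G⊢ ((φ ∨ⁿ ψ) ∷ Φ)
  ∧rule   : ∀ {Φ φ ψ} → G⊢ (φ ∷ Φ) → G⊢ (ψ ∷ Φ) → G⊢ ((φ ∧ⁿ ψ) ∷ Φ)
  *rule   : ∀ {Φ γ φ} → G⊢ ((φ ∨ⁿ (⟨ γ ⟩ⁿ ⟨ γ *ⁿ ⟩ⁿ φ)) ∷ Φ) → G⊢ ((⟨ γ *ⁿ ⟩ⁿ φ) ∷ Φ)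
  ×rule   : ∀ {Φ γ φ} → G⊢ ((φ ∧ⁿ (⟨ γ ⟩ⁿ ⟨ γ ×ⁿ ⟩ⁿ φ)) ∷ Φ) → G⊢ ((⟨ γ ×ⁿ ⟩ⁿ φ) ∷ Φ)
  ⊔rule   : ∀ {Φ γ δ φ} → G⊢ (((⟨ γ ⟩ⁿ φ) ∨ⁿ (⟨ δ ⟩ⁿ φ)) ∷ Φ) → G⊢ ((⟨ γ ⊔ⁿ δ ⟩ⁿ φ) ∷ Φ)
  ⊓rule   : ∀ {Φ γ δ φ} → G⊢ (((⟨ γ ⟩ⁿ φ) ∧ⁿ (⟨ δ ⟩ⁿ φ)) ∷ Φ) → G⊢ ((⟨ γ ⊓ⁿ δ ⟩ⁿ φ) ∷ Φ)
  ?rule   : ∀ {Φ ψ φ} → G⊢ ((ψ ∧ⁿ φ) ∷ Φ) → G⊢ ((⟨ ψ ?ⁿ ⟩ⁿ φ) ∷ Φ)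
  !rule   : ∀ {Φ ψ φ} → G⊢ ((ψ ∨ⁿ φ) ∷ Φ) → G⊢ ((⟨ ψ !ⁿ ⟩ⁿ φ) ∷ Φ)
  deep!G  : ∀ {Φ χ γ} (c : FCtx gsort) → G⊢ (plugF c γ ∷ Φ) → G⊢ (plugF c ((χ !ⁿ) ⨟ⁿ γ) ∷ Φ)
  deep!F  : ∀ {Φ χ φ} (c : FCtx fsort) → G⊢ (plugF c φ ∷ Φ) → G⊢ (plugF c (⟨ χ !ⁿ ⟩ⁿ φ) ∷ Φ)
  deep⨟   : ∀ {Φ γ δ φ} (c : FCtx fsort) → G⊢ (plugF c (⟨ γ ⟩ⁿ ⟨ δ ⟩ⁿ φ) ∷ Φ) → G⊢ (plugF c (⟨ γ ⨟ⁿ δ ⟩ⁿ φ) ∷ Φ)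
  ×ind    : ∀ {γ φ} ψ Ψ → Unique (ψ ∷ Ψ) →
            G⊢ ((φ ∧ⁿ (⟨ γ ⟩ⁿ ⟨ (((compSet ψ Ψ) !ⁿ) ⨟ⁿ γ) ×ⁿ ⟩ⁿ ⟨ (compSet ψ Ψ) !ⁿ ⟩ⁿ φ)) ∷ ψ ∷ Ψ) →
            G⊢ ((⟨ γ ×ⁿ ⟩ⁿ φ) ∷ ψ ∷ Ψ)

-- Both parts reduce to soundness of G with respect to Par under (·)^par,
-- reading a sequent as the disjunction of its members.  The normal-form
-- connectives ⊓, ×, ! are Par-definable through duality, and Par proves
-- their unfolding laws; in particular α× is the greatest post-fixpoint of
-- θ ∧ ⟨α⟩(·), which is exactly what the ×-induction rule needs.  Complement
-- and (·)^nf are correct up to Par-equivalence (φ̄ ≃ ¬φ, γ̌ ≋ γᵈ, φ^nf ≃ φ),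
-- and G-provability of φ^nf then transfers back to φ.
module Submission where

-- Defs declares _∧ᵖ_ without a fixity.
open import Defs renaming (_∧ᵖ_ to infixr 7 _∧ᵖ_)
open import Data.Bool using (Bool; true; false; not; _∨_; _∧_; T)
open import Data.Bool.Properties using (T-∧; T-≡)
open import Data.Fin using (Fin; #_)
open import Data.List using (List; []; _∷_)
open import Data.List.Membership.Propositional using (_∈_)
open import Data.List.Relation.Unary.Any using (here; there)
open import Data.Nat using (ℕ; zero; suc)
open import Data.Product using (_×_; _,_; proj₁; proj₂)
open import Data.Vec using (Vec; []; _∷_; lookup; map)
open import Data.Vec.Properties using (lookup-map)
open import Function.Bundles using (Equivalence)
open import Relation.Binary.Bundles using (Preorder)
open import Relation.Binary.Structures using (IsPreorder)
open import Relation.Binary.PropositionalEquality using (_≡_; refl; sym; trans; cong; cong₂)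
import Relation.Binary.Reasoning.Preorder as PreorderReasoning

variable
  n : ℕ
  A B C D θ χ N : Fm
  α α′ β β′ : Gm

-- Propositional schemas and their instances as tautologies

infixr 6 _∨ˢ_ _∧ˢ_
infixr 5 _⇒ˢ_
infix 4 _⇔ˢ_

data Schema (n : ℕ) : Set where
  var  : Fin n → Schema n
  ¬ˢ_  : Schema n → Schema n
  _∨ˢ_ : Schema n → Schema n → Schema n

_⇒ˢ_ _∧ˢ_ _⇔ˢ_ : Schema n → Schema n → Schema n
P ⇒ˢ Q = ¬ˢ P ∨ˢ Q
P ∧ˢ Q = ¬ˢ (¬ˢ P ∨ˢ ¬ˢ Q)
P ⇔ˢ Q = (P ⇒ˢ Q) ∧ˢ (Q ⇒ˢ P)

instantiate : Schema n → Vec Fm n → Fm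
instantiate (var i)  σ = lookup σ i
instantiate (¬ˢ P)   σ = ¬ᵖ instantiate P σ
instantiate (P ∨ˢ Q) σ = instantiate P σ ∨ᵖ instantiate Q σ

evalˢ : Schema n → Vec Bool n → Bool
evalˢ (var i)  ρ = lookup ρ i
evalˢ (¬ˢ P)   ρ = not (evalˢ P ρ)
evalˢ (P ∨ˢ Q) ρ = evalˢ P ρ ∨ evalˢ Q ρ

valid : ∀ n → (Vec Bool n → Bool) → Bool
valid zero    f = f []
valid (suc n) f = valid n (λ ρ → f (true ∷ ρ)) ∧ valid n (λ ρ → f (false ∷ ρ))

valid-sound : ∀ n f → T (valid n f) → ∀ ρ → T (f ρ)
valid-sound zero    f t []          = t
valid-sound (suc n) f t (true ∷ ρ)  = valid-sound n _ (proj₁ (Equivalence.to T-∧ t)) ρ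
valid-sound (suc n) f t (false ∷ ρ) = valid-sound n _ (proj₂ (Equivalence.to T-∧ t)) ρ

evalP-instantiate : ∀ (P : Schema n) σ v → evalP v (instantiate P σ) ≡ evalˢ P (map (evalP v) σ)
evalP-instantiate (var i)  σ v = sym (lookup-map i (evalP v) σ)
evalP-instantiate (¬ˢ P)   σ v = cong not (evalP-instantiate P σ v)
evalP-instantiate (P ∨ˢ Q) σ v = cong₂ _∨_ (evalP-instantiate P σ v) (evalP-instantiate Q σ v)

-- The implicit side condition reduces to ⊤ for a valid schema, so it is discharged by evaluation.
tautology : (P : Schema n) (σ : Vec Fm n) {_ : T (valid n (evalˢ P))} → Par⊢ instantiate P σ
tautology {n} P σ {t} = taut λ v →
  trans (evalP-instantiate P σ v) (Equivalence.to T-≡ (valid-sound n (evalˢ P) t (map (evalP v) σ)))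

private
  x₀ : Schema (suc n)
  x₀ = var (# 0)
  x₁ : Schema (suc (suc n))
  x₁ = var (# 1)
  x₂ : Schema (suc (suc (suc n)))
  x₂ = var (# 2)

infixl 5 _·_
_·_ : Par⊢ (A →ᵖ B) → Par⊢ A → Par⊢ B
_·_ = mp

infix 4 _⊑_ _≃_

_⊑_ : Fm → Fm → Set
A ⊑ B = Par⊢ (A →ᵖ B)

_≃_ : Fm → Fm → Set
A ≃ B = A ⊑ B × B ⊑ A

≃⇒⊑ : A ≃ B → A ⊑ B
≃⇒⊑ = proj₁

≃⇒⊒ : A ≃ B → B ⊑ A
≃⇒⊒ = proj₂

⊑-refl : A ⊑ A
⊑-refl {A} = tautology (x₀ ⇒ˢ x₀) (A ∷ [])

⊑-trans : A ⊑ B → B ⊑ C → A ⊑ C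
⊑-trans {A} {B} {C} h k =
  tautology ((x₀ ⇒ˢ x₁) ⇒ˢ (x₁ ⇒ˢ x₂) ⇒ˢ x₀ ⇒ˢ x₂) (A ∷ B ∷ C ∷ []) · h · k

≃-refl : A ≃ A
≃-refl = ⊑-refl , ⊑-refl

≃-sym : A ≃ B → B ≃ A
≃-sym (h , k) = k , h

≃-trans : A ≃ B → B ≃ C → A ≃ C
≃-trans (h , k) (h′ , k′) = ⊑-trans h h′ , ⊑-trans k′ k

⊑-isPreorder : IsPreorder _≃_ _⊑_
⊑-isPreorder = record
  { isEquivalence = record { refl = ≃-refl ; sym = ≃-sym ; trans = ≃-trans }
  ; reflexive     = ≃⇒⊑
  ; trans         = ⊑-trans
  }

⊑-preorder : Preorder _ _ _
⊑-preorder = record { isPreorder = ⊑-isPreorder }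

open PreorderReasoning ⊑-preorder

↔⇒≃ : Par⊢ (A ↔ᵖ B) → A ≃ B
↔⇒≃ {A} {B} h = tautology ((x₀ ⇔ˢ x₁) ⇒ˢ x₀ ⇒ˢ x₁) (A ∷ B ∷ []) · h
              , tautology ((x₀ ⇔ˢ x₁) ⇒ˢ x₁ ⇒ˢ x₀) (A ∷ B ∷ []) · h

¬-anti : A ⊑ B → ¬ᵖ B ⊑ ¬ᵖ A
¬-anti {A} {B} h = tautology ((x₀ ⇒ˢ x₁) ⇒ˢ ¬ˢ x₁ ⇒ˢ ¬ˢ x₀) (A ∷ B ∷ []) · h

¬-cong : A ≃ B → ¬ᵖ A ≃ ¬ᵖ B
¬-cong (h , k) = ¬-anti k , ¬-anti h

¬¬ : ¬ᵖ ¬ᵖ A ≃ A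
¬¬ {A} = tautology (¬ˢ ¬ˢ x₀ ⇒ˢ x₀) (A ∷ []) , tautology (x₀ ⇒ˢ ¬ˢ ¬ˢ x₀) (A ∷ [])

∨-injˡ : A ⊑ A ∨ᵖ B
∨-injˡ {A} {B} = tautology (x₀ ⇒ˢ x₀ ∨ˢ x₁) (A ∷ B ∷ [])

∨-injʳ : B ⊑ A ∨ᵖ B
∨-injʳ {B} {A} = tautology (x₁ ⇒ˢ x₀ ∨ˢ x₁) (A ∷ B ∷ [])

∨-elim : A ⊑ C → B ⊑ C → A ∨ᵖ B ⊑ C
∨-elim {A} {C} {B} h k =
  tautology ((x₀ ⇒ˢ x₂) ⇒ˢ (x₁ ⇒ˢ x₂) ⇒ˢ x₀ ∨ˢ x₁ ⇒ˢ x₂) (A ∷ B ∷ C ∷ []) · h · k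

∨-mono : A ⊑ B → C ⊑ D → A ∨ᵖ C ⊑ B ∨ᵖ D
∨-mono h k = ∨-elim (⊑-trans h ∨-injˡ) (⊑-trans k ∨-injʳ)

∨-cong : A ≃ B → C ≃ D → A ∨ᵖ C ≃ B ∨ᵖ D
∨-cong (h , k) (h′ , k′) = ∨-mono h h′ , ∨-mono k k′

∨-assoc : A ∨ᵖ (B ∨ᵖ C) ⊑ (A ∨ᵖ B) ∨ᵖ C
∨-assoc = ∨-elim (⊑-trans ∨-injˡ ∨-injˡ) (∨-mono ∨-injʳ ⊑-refl)

∧-projˡ : A ∧ᵖ B ⊑ A
∧-projˡ {A} {B} = tautology (x₀ ∧ˢ x₁ ⇒ˢ x₀) (A ∷ B ∷ [])

∧-projʳ : A ∧ᵖ B ⊑ B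
∧-projʳ {A} {B} = tautology (x₀ ∧ˢ x₁ ⇒ˢ x₁) (A ∷ B ∷ [])

∧-pair : C ⊑ A → C ⊑ B → C ⊑ A ∧ᵖ B
∧-pair {C} {A} {B} h k =
  tautology ((x₂ ⇒ˢ x₀) ⇒ˢ (x₂ ⇒ˢ x₁) ⇒ˢ x₂ ⇒ˢ x₀ ∧ˢ x₁) (A ∷ B ∷ C ∷ []) · h · k

∧-mono : A ⊑ B → C ⊑ D → A ∧ᵖ C ⊑ B ∧ᵖ D
∧-mono h k = ∧-pair (⊑-trans ∧-projˡ h) (⊑-trans ∧-projʳ k)

∧-cong : A ≃ B → C ≃ D → A ∧ᵖ C ≃ B ∧ᵖ D
∧-cong (h , k) (h′ , k′) = ∧-mono h h′ , ∧-mono k k′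

∨-distribˡ-∧ : (A ∨ᵖ B) ∧ᵖ (A ∨ᵖ C) ⊑ A ∨ᵖ (B ∧ᵖ C)
∨-distribˡ-∧ {A} {B} {C} =
  tautology ((x₀ ∨ˢ x₁) ∧ˢ (x₀ ∨ˢ x₂) ⇒ˢ x₀ ∨ˢ (x₁ ∧ˢ x₂)) (A ∷ B ∷ C ∷ [])

¬-∨ : ¬ᵖ (A ∨ᵖ B) ≃ ¬ᵖ A ∧ᵖ ¬ᵖ B
¬-∨ = ¬-cong (∨-cong (≃-sym ¬¬) (≃-sym ¬¬))

¬-∧ : ¬ᵖ (A ∧ᵖ B) ≃ ¬ᵖ A ∨ᵖ ¬ᵖ B
¬-∧ = ¬¬

⊢∨⇒¬⊑ : Par⊢ (A ∨ᵖ B) → ¬ᵖ B ⊑ A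
⊢∨⇒¬⊑ {A} {B} h = tautology (x₀ ∨ˢ x₁ ⇒ˢ ¬ˢ x₁ ⇒ˢ x₀) (A ∷ B ∷ []) · h

¬⊑⇒⊢∨ : ¬ᵖ B ⊑ A → Par⊢ (A ∨ᵖ B)
¬⊑⇒⊢∨ {B} {A} h = tautology ((¬ˢ x₁ ⇒ˢ x₀) ⇒ˢ x₀ ∨ˢ x₁) (A ∷ B ∷ []) · h

⊢-∨-monoˡ : A ⊑ B → Par⊢ (A ∨ᵖ C) → Par⊢ (B ∨ᵖ C)
⊢-∨-monoˡ h = mp (∨-mono h ⊑-refl)

⊢-∧-∨ : Par⊢ (A ∨ᵖ C) → Par⊢ (B ∨ᵖ C) → Par⊢ ((A ∧ᵖ B) ∨ᵖ C)
⊢-∧-∨ h k = ¬⊑⇒⊢∨ (∧-pair (⊢∨⇒¬⊑ h) (⊢∨⇒¬⊑ k))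

⊥ᵖ : Fm
⊥ᵖ = ¬ᵖ (atom 0 →ᵖ atom 0)

⊥ᵖ-⊑ : ⊥ᵖ ⊑ A
⊥ᵖ-⊑ {A} = tautology (¬ˢ (x₀ ⇒ˢ x₀) ⇒ˢ x₁) (atom 0 ∷ A ∷ [])

∨-⊥ : A ∨ᵖ ⊥ᵖ ≃ A
∨-⊥ = ∨-elim ⊑-refl ⊥ᵖ-⊑ , ∨-injˡ

infix 4 _≼_ _≋_

_≼_ : Gm → Gm → Set
α ≼ β = ∀ θ → ⟨ α ⟩ᵖ θ ⊑ ⟨ β ⟩ᵖ θ

_≋_ : Gm → Gm → Set
α ≋ β = ∀ θ → ⟨ α ⟩ᵖ θ ≃ ⟨ β ⟩ᵖ θ

≋-refl : α ≋ α
≋-refl θ = ≃-refl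

≋-sym : α ≋ β → β ≋ α
≋-sym e θ = ≃-sym (e θ)

≋-trans : α ≋ β → β ≋ α′ → α ≋ α′
≋-trans e f θ = ≃-trans (e θ) (f θ)

≋⇒≼ : α ≋ β → α ≼ β
≋⇒≼ e θ = ≃⇒⊑ (e θ)

≋⇒≽ : α ≋ β → β ≼ α
≋⇒≽ e θ = ≃⇒⊒ (e θ)

⟨⟩-mono : α ≼ β → A ⊑ B → ⟨ α ⟩ᵖ A ⊑ ⟨ β ⟩ᵖ B
⟨⟩-mono {α} h k = ⊑-trans (mono α k) (h _)

⟨⟩-cong : α ≋ β → A ≃ B → ⟨ α ⟩ᵖ A ≃ ⟨ β ⟩ᵖ B
⟨⟩-cong e (h , k) = ⟨⟩-mono (≋⇒≼ e) h , ⟨⟩-mono (≋⇒≽ e) k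

⟨⟩-congʳ : A ≃ B → ⟨ α ⟩ᵖ A ≃ ⟨ α ⟩ᵖ B
⟨⟩-congʳ = ⟨⟩-cong ≋-refl

⨟-≃ : ⟨ α ⨟ᵖ β ⟩ᵖ θ ≃ ⟨ α ⟩ᵖ ⟨ β ⟩ᵖ θ
⨟-≃ = ↔⇒≃ (ax-seq _ _ _)

⊔-≃ : ⟨ α ⊔ᵖ β ⟩ᵖ θ ≃ ⟨ α ⟩ᵖ θ ∨ᵖ ⟨ β ⟩ᵖ θ
⊔-≃ = ↔⇒≃ (ax-cho _ _ _)

*-≃ : ⟨ α *ᵖ ⟩ᵖ θ ≃ θ ∨ᵖ ⟨ α ⟩ᵖ ⟨ α *ᵖ ⟩ᵖ θ
*-≃ = ↔⇒≃ (ax-itr _ _)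

?-≃ : ⟨ A ?ᵖ ⟩ᵖ θ ≃ A ∧ᵖ θ
?-≃ = ↔⇒≃ (ax-tst _ _)

ᵈ-≃ : ⟨ α ᵈᵖ ⟩ᵖ θ ≃ ¬ᵖ ⟨ α ⟩ᵖ ¬ᵖ θ
ᵈ-≃ = ↔⇒≃ (ax-dua _ _)

ᵈ-¬ : ⟨ α ᵈᵖ ⟩ᵖ ¬ᵖ θ ≃ ¬ᵖ ⟨ α ⟩ᵖ θ
ᵈ-¬ = ≃-trans ᵈ-≃ (¬-cong (⟨⟩-congʳ ¬¬))

¬-ᵈ : ¬ᵖ ⟨ α ᵈᵖ ⟩ᵖ θ ≃ ⟨ α ⟩ᵖ ¬ᵖ θ
¬-ᵈ = ≃-trans (¬-cong ᵈ-≃) ¬¬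

*-ind : θ ⊑ A → ⟨ α ⟩ᵖ A ⊑ A → ⟨ α *ᵖ ⟩ᵖ θ ⊑ A
*-ind {α = α} h k = ⊑-trans (mono (α *ᵖ) h) (barind k)

ᵈ-anti : α ≼ β → β ᵈᵖ ≼ α ᵈᵖ
ᵈ-anti {α} {β} h θ = begin
  ⟨ β ᵈᵖ ⟩ᵖ θ       ≈⟨ ᵈ-≃ ⟩
  ¬ᵖ ⟨ β ⟩ᵖ ¬ᵖ θ    ≲⟨ ¬-anti (h (¬ᵖ θ)) ⟩
  ¬ᵖ ⟨ α ⟩ᵖ ¬ᵖ θ    ≈⟨ ᵈ-≃ ⟨
  ⟨ α ᵈᵖ ⟩ᵖ θ       ∎

⨟-mono : α ≼ α′ → β ≼ β′ → α ⨟ᵖ β ≼ α′ ⨟ᵖ β′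
⨟-mono {α} {α′} {β} {β′} h k θ = begin
  ⟨ α ⨟ᵖ β ⟩ᵖ θ        ≈⟨ ⨟-≃ ⟩
  ⟨ α ⟩ᵖ ⟨ β ⟩ᵖ θ      ≲⟨ ⟨⟩-mono h (k θ) ⟩
  ⟨ α′ ⟩ᵖ ⟨ β′ ⟩ᵖ θ    ≈⟨ ⨟-≃ ⟨
  ⟨ α′ ⨟ᵖ β′ ⟩ᵖ θ      ∎

⊔-mono : α ≼ α′ → β ≼ β′ → α ⊔ᵖ β ≼ α′ ⊔ᵖ β′
⊔-mono h k θ = ⊑-trans (≃⇒⊑ ⊔-≃) (⊑-trans (∨-mono (h θ) (k θ)) (≃⇒⊒ ⊔-≃))

*-mono : α ≼ β → α *ᵖ ≼ β *ᵖ
*-mono h θ = *-ind (⊑-trans ∨-injˡ (≃⇒⊒ *-≃)) (⊑-trans (h _) (⊑-trans ∨-injʳ (≃⇒⊒ *-≃)))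

?-mono : A ⊑ B → A ?ᵖ ≼ B ?ᵖ
?-mono h θ = ⊑-trans (≃⇒⊑ ?-≃) (⊑-trans (∧-mono h ⊑-refl) (≃⇒⊒ ?-≃))

ᵈ-cong : α ≋ β → α ᵈᵖ ≋ β ᵈᵖ
ᵈ-cong e θ = ᵈ-anti (≋⇒≽ e) θ , ᵈ-anti (≋⇒≼ e) θ

⨟-cong : α ≋ α′ → β ≋ β′ → α ⨟ᵖ β ≋ α′ ⨟ᵖ β′
⨟-cong e f θ = ⨟-mono (≋⇒≼ e) (≋⇒≼ f) θ , ⨟-mono (≋⇒≽ e) (≋⇒≽ f) θ

⊔-cong : α ≋ α′ → β ≋ β′ → α ⊔ᵖ β ≋ α′ ⊔ᵖ β′
⊔-cong e f θ = ⊔-mono (≋⇒≼ e) (≋⇒≼ f) θ , ⊔-mono (≋⇒≽ e) (≋⇒≽ f) θ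

*-cong : α ≋ β → α *ᵖ ≋ β *ᵖ
*-cong e θ = *-mono (≋⇒≼ e) θ , *-mono (≋⇒≽ e) θ

?-cong : A ≃ B → A ?ᵖ ≋ B ?ᵖ
?-cong (h , k) θ = ?-mono h θ , ?-mono k θ

ᵈᵈ : α ᵈᵖ ᵈᵖ ≋ α
ᵈᵈ {α} θ = begin-equality
  ⟨ α ᵈᵖ ᵈᵖ ⟩ᵖ θ          ≈⟨ ᵈ-≃ ⟩
  ¬ᵖ ⟨ α ᵈᵖ ⟩ᵖ ¬ᵖ θ       ≈⟨ ¬-cong ᵈ-¬ ⟩
  ¬ᵖ ¬ᵖ ⟨ α ⟩ᵖ θ          ≈⟨ ¬¬ ⟩
  ⟨ α ⟩ᵖ θ                ∎

⨟-ᵈ : (α ⨟ᵖ β) ᵈᵖ ≋ α ᵈᵖ ⨟ᵖ β ᵈᵖ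
⨟-ᵈ {α} {β} θ = begin-equality
  ⟨ (α ⨟ᵖ β) ᵈᵖ ⟩ᵖ θ               ≈⟨ ᵈ-≃ ⟩
  ¬ᵖ ⟨ α ⨟ᵖ β ⟩ᵖ ¬ᵖ θ              ≈⟨ ¬-cong ⨟-≃ ⟩
  ¬ᵖ ⟨ α ⟩ᵖ ⟨ β ⟩ᵖ ¬ᵖ θ            ≈⟨ ¬-cong (⟨⟩-congʳ ¬-ᵈ) ⟨
  ¬ᵖ ⟨ α ⟩ᵖ ¬ᵖ ⟨ β ᵈᵖ ⟩ᵖ θ         ≈⟨ ᵈ-≃ ⟨
  ⟨ α ᵈᵖ ⟩ᵖ ⟨ β ᵈᵖ ⟩ᵖ θ            ≈⟨ ⨟-≃ ⟨
  ⟨ α ᵈᵖ ⨟ᵖ β ᵈᵖ ⟩ᵖ θ              ∎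

-- Demonic choice, demonic iteration and assertion inside Par

-- The (·)^par images of ⊓, × and !, so that e.g. parG (γ ×ⁿ) reduces to parG γ ×ᵖ.
infixr 6 _⊓ᵖ_

_⊓ᵖ_ : Gm → Gm → Gm
α ⊓ᵖ β = (α ᵈᵖ ⊔ᵖ β ᵈᵖ) ᵈᵖ

_×ᵖ : Gm → Gm
α ×ᵖ = (α ᵈᵖ *ᵖ) ᵈᵖ

_!ᵖ : Fm → Gm
A !ᵖ = ((¬ᵖ A) ?ᵖ) ᵈᵖ

⊓-≃ : ⟨ α ⊓ᵖ β ⟩ᵖ θ ≃ ⟨ α ⟩ᵖ θ ∧ᵖ ⟨ β ⟩ᵖ θ
⊓-≃ {α} {β} {θ} = begin-equality
  ⟨ α ⊓ᵖ β ⟩ᵖ θ                                ≈⟨ ᵈ-≃ ⟩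
  ¬ᵖ ⟨ α ᵈᵖ ⊔ᵖ β ᵈᵖ ⟩ᵖ ¬ᵖ θ                    ≈⟨ ¬-cong ⊔-≃ ⟩
  ¬ᵖ (⟨ α ᵈᵖ ⟩ᵖ ¬ᵖ θ ∨ᵖ ⟨ β ᵈᵖ ⟩ᵖ ¬ᵖ θ)        ≈⟨ ¬-cong (∨-cong ᵈ-¬ ᵈ-¬) ⟩
  ⟨ α ⟩ᵖ θ ∧ᵖ ⟨ β ⟩ᵖ θ                         ∎

×-≃ : ⟨ α ×ᵖ ⟩ᵖ θ ≃ θ ∧ᵖ ⟨ α ⟩ᵖ ⟨ α ×ᵖ ⟩ᵖ θ
×-≃ {α} {θ} = begin-equality
  ⟨ α ×ᵖ ⟩ᵖ θ                                          ≈⟨ ᵈ-≃ ⟩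
  ¬ᵖ ⟨ α ᵈᵖ *ᵖ ⟩ᵖ ¬ᵖ θ                                 ≈⟨ ¬-cong *-≃ ⟩
  ¬ᵖ (¬ᵖ θ ∨ᵖ ⟨ α ᵈᵖ ⟩ᵖ ⟨ α ᵈᵖ *ᵖ ⟩ᵖ ¬ᵖ θ)             ≈⟨ ¬-cong (∨-cong ≃-refl ᵈ-≃) ⟩
  ¬ᵖ (¬ᵖ θ ∨ᵖ ¬ᵖ ⟨ α ⟩ᵖ ¬ᵖ ⟨ α ᵈᵖ *ᵖ ⟩ᵖ ¬ᵖ θ)         ≈⟨ ¬-cong (∨-cong ≃-refl (¬-cong (⟨⟩-congʳ ᵈ-≃))) ⟨
  θ ∧ᵖ ⟨ α ⟩ᵖ ⟨ α ×ᵖ ⟩ᵖ θ                              ∎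

!-≃ : ⟨ N !ᵖ ⟩ᵖ θ ≃ N ∨ᵖ θ
!-≃ {N} {θ} = begin-equality
  ⟨ N !ᵖ ⟩ᵖ θ                  ≈⟨ ᵈ-≃ ⟩
  ¬ᵖ ⟨ (¬ᵖ N) ?ᵖ ⟩ᵖ ¬ᵖ θ       ≈⟨ ¬-cong ?-≃ ⟩
  ¬ᵖ (¬ᵖ N ∧ᵖ ¬ᵖ θ)            ≈⟨ ¬-∧ ⟩
  ¬ᵖ ¬ᵖ N ∨ᵖ ¬ᵖ ¬ᵖ θ           ≈⟨ ∨-cong ¬¬ ¬¬ ⟩
  N ∨ᵖ θ                       ∎

!-intro : θ ⊑ ⟨ N !ᵖ ⟩ᵖ θ
!-intro = ⊑-trans ∨-injʳ (≃⇒⊒ !-≃)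

!⨟-intro : α ≼ N !ᵖ ⨟ᵖ α
!⨟-intro θ = ⊑-trans !-intro (≃⇒⊒ ⨟-≃)

-- Bar induction for αᵈ, read through duality.
×-coind : χ ⊑ θ ∧ᵖ ⟨ α ⟩ᵖ χ → χ ⊑ ⟨ α ×ᵖ ⟩ᵖ θ
×-coind {χ} {θ} {α} h = begin
  χ                             ≲⟨ ≃⇒⊒ ¬¬ ⟩
  ¬ᵖ ¬ᵖ χ                       ≲⟨ ¬-anti (*-ind (¬-anti (⊑-trans h ∧-projˡ)) step) ⟩
  ¬ᵖ ⟨ α ᵈᵖ *ᵖ ⟩ᵖ ¬ᵖ θ          ≈⟨ ᵈ-≃ ⟨
  ⟨ α ×ᵖ ⟩ᵖ θ                   ∎
  where
  step : ⟨ α ᵈᵖ ⟩ᵖ ¬ᵖ χ ⊑ ¬ᵖ χ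
  step = ⊑-trans (≃⇒⊑ ᵈ-¬) (¬-anti (⊑-trans h ∧-projʳ))

-- The invariant is  ⟨(N!;α)×⟩⟨N!⟩θ ∨ N : along the guarded iteration
-- either N has been reached, where the hypothesis restarts the play, or
-- the guarded play simply continues.
×-coind-guarded : N ⊑ θ ∧ᵖ ⟨ α ⟩ᵖ ⟨ (N !ᵖ ⨟ᵖ α) ×ᵖ ⟩ᵖ ⟨ N !ᵖ ⟩ᵖ θ → N ⊑ ⟨ α ×ᵖ ⟩ᵖ θ
×-coind-guarded {N} {θ} {α} h = ⊑-trans ∨-injʳ (×-coind invariant)
  where
  X : Fm
  X = ⟨ (N !ᵖ ⨟ᵖ α) ×ᵖ ⟩ᵖ ⟨ N !ᵖ ⟩ᵖ θ

  X-step : X ⊑ θ ∧ᵖ ⟨ α ⟩ᵖ X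
  X-step = begin
    X                                           ≈⟨ ×-≃ ⟩
    ⟨ N !ᵖ ⟩ᵖ θ ∧ᵖ ⟨ N !ᵖ ⨟ᵖ α ⟩ᵖ X             ≈⟨ ∧-cong !-≃ (≃-trans ⨟-≃ !-≃) ⟩
    (N ∨ᵖ θ) ∧ᵖ (N ∨ᵖ ⟨ α ⟩ᵖ X)                 ≲⟨ ∨-distribˡ-∧ ⟩
    N ∨ᵖ (θ ∧ᵖ ⟨ α ⟩ᵖ X)                        ≲⟨ ∨-elim h ⊑-refl ⟩
    θ ∧ᵖ ⟨ α ⟩ᵖ X                               ∎

  invariant : X ∨ᵖ N ⊑ θ ∧ᵖ ⟨ α ⟩ᵖ (X ∨ᵖ N)
  invariant = ⊑-trans (∨-elim X-step h) (∧-mono ⊑-refl (mono α ∨-injˡ))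

⊓-mono : α ≼ α′ → β ≼ β′ → α ⊓ᵖ β ≼ α′ ⊓ᵖ β′
⊓-mono h k = ᵈ-anti (⊔-mono (ᵈ-anti h) (ᵈ-anti k))

×-mono : α ≼ β → α ×ᵖ ≼ β ×ᵖ
×-mono h = ᵈ-anti (*-mono (ᵈ-anti h))

!-mono : A ⊑ B → A !ᵖ ≼ B !ᵖ
!-mono h = ᵈ-anti (?-mono (¬-anti h))

⊓-cong : α ≋ α′ → β ≋ β′ → α ⊓ᵖ β ≋ α′ ⊓ᵖ β′
⊓-cong e f = ᵈ-cong (⊔-cong (ᵈ-cong e) (ᵈ-cong f))

×-cong : α ≋ β → α ×ᵖ ≋ β ×ᵖ
×-cong e = ᵈ-cong (*-cong (ᵈ-cong e))

!-cong : A ≃ B → A !ᵖ ≋ B !ᵖ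
!-cong e = ᵈ-cong (?-cong (¬-cong e))

⊔-ᵈ : (α ⊔ᵖ β) ᵈᵖ ≋ α ᵈᵖ ⊓ᵖ β ᵈᵖ
⊔-ᵈ = ᵈ-cong (⊔-cong (≋-sym ᵈᵈ) (≋-sym ᵈᵈ))

*-ᵈ : α *ᵖ ᵈᵖ ≋ α ᵈᵖ ×ᵖ
*-ᵈ = ᵈ-cong (*-cong (≋-sym ᵈᵈ))

?-ᵈ : A ?ᵖ ᵈᵖ ≋ (¬ᵖ A) !ᵖ
?-ᵈ = ᵈ-cong (?-cong (≃-sym ¬¬))

Refines : (s : Sort) → HoleT s → HoleT s → Set
Refines fsort φ ψ = par φ ⊑ par ψ
Refines gsort γ δ = parG γ ≼ parG δ

plugF-mono : ∀ {s} (c : FCtx s) {x y} → Refines s x y → par (plugF c x) ⊑ par (plugF c y)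
plugG-mono : ∀ {s} (c : GCtx s) {x y} → Refines s x y → parG (plugG c x) ≼ parG (plugG c y)

plugF-mono fhole     r = r
plugF-mono (∨L c ψ)  r = ∨-mono (plugF-mono c r) ⊑-refl
plugF-mono (∨R ψ c)  r = ∨-mono ⊑-refl (plugF-mono c r)
plugF-mono (∧L c ψ)  r = ∧-mono (plugF-mono c r) ⊑-refl
plugF-mono (∧R ψ c)  r = ∧-mono ⊑-refl (plugF-mono c r)
plugF-mono (⟨⟩G c ψ) r = plugG-mono c r (par ψ)
plugF-mono (⟨⟩F γ c) r = mono (parG γ) (plugF-mono c r)

plugG-mono ghole    r = r
plugG-mono (⨟L c δ) r = ⨟-mono (plugG-mono c r) (λ _ → ⊑-refl)
plugG-mono (⨟R δ c) r = ⨟-mono (λ _ → ⊑-refl) (plugG-mono c r)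
plugG-mono (⊔L c δ) r = ⊔-mono (plugG-mono c r) (λ _ → ⊑-refl)
plugG-mono (⊔R δ c) r = ⊔-mono (λ _ → ⊑-refl) (plugG-mono c r)
plugG-mono (⊓L c δ) r = ⊓-mono (plugG-mono c r) (λ _ → ⊑-refl)
plugG-mono (⊓R δ c) r = ⊓-mono (λ _ → ⊑-refl) (plugG-mono c r)
plugG-mono (*C c)   r = *-mono (plugG-mono c r)
plugG-mono (×C c)   r = ×-mono (plugG-mono c r)
plugG-mono (?C c)   r = ?-mono (plugF-mono c r)
plugG-mono (!C c)   r = !-mono (plugF-mono c r)

-- Complement and the normal-form translation are correct in Par

comp-correct  : ∀ φ → par (comp φ) ≃ ¬ᵖ par φ
compG-correct : ∀ γ → parG (compG γ) ≋ parG γ ᵈᵖ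

comp-correct (pos p)    = ≃-refl
comp-correct (neg p)    = ≃-sym ¬¬
comp-correct (φ ∨ⁿ ψ)   = ≃-trans (∧-cong (comp-correct φ) (comp-correct ψ)) (≃-sym ¬-∨)
comp-correct (φ ∧ⁿ ψ)   = ≃-trans (∨-cong (comp-correct φ) (comp-correct ψ)) (≃-sym ¬-∧)
comp-correct (⟨ γ ⟩ⁿ φ) = ≃-trans (⟨⟩-cong (compG-correct γ) (comp-correct φ)) ᵈ-¬

compG-correct (gⁿ g)   = ≋-refl
compG-correct (gdⁿ g)  = ≋-sym ᵈᵈ
compG-correct (γ ⨟ⁿ δ) = ≋-trans (⨟-cong (compG-correct γ) (compG-correct δ)) (≋-sym ⨟-ᵈ)
compG-correct (γ ⊔ⁿ δ) = ≋-trans (⊓-cong (compG-correct γ) (compG-correct δ)) (≋-sym ⊔-ᵈ)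
compG-correct (γ ⊓ⁿ δ) = ≋-trans (⊔-cong (compG-correct γ) (compG-correct δ)) (≋-sym ᵈᵈ)
compG-correct (γ *ⁿ)   = ≋-trans (×-cong (compG-correct γ)) (≋-sym *-ᵈ)
compG-correct (γ ×ⁿ)   = ≋-trans (*-cong (compG-correct γ)) (≋-sym ᵈᵈ)
compG-correct (φ ?ⁿ)   = ≋-trans (!-cong (comp-correct φ)) (≋-sym ?-ᵈ)
compG-correct (φ !ⁿ)   = ≋-trans (?-cong (comp-correct φ)) (≋-sym ᵈᵈ)

nf-correct    : ∀ φ → par (nf φ) ≃ φ
nfNeg-correct : ∀ φ → par (nfNeg φ) ≃ ¬ᵖ φ
nfG-correct   : ∀ γ → parG (nfG γ) ≋ γ
nfGd-correct  : ∀ γ → parG (nfGd γ) ≋ γ ᵈᵖ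

nf-correct (atom p)   = ≃-refl
nf-correct (¬ᵖ φ)     = nfNeg-correct φ
nf-correct (φ ∨ᵖ ψ)   = ∨-cong (nf-correct φ) (nf-correct ψ)
nf-correct (⟨ γ ⟩ᵖ φ) = ⟨⟩-cong (nfG-correct γ) (nf-correct φ)

nfNeg-correct (atom p)   = ≃-refl
nfNeg-correct (¬ᵖ φ)     = ≃-trans (nf-correct φ) (≃-sym ¬¬)
nfNeg-correct (φ ∨ᵖ ψ)   = ≃-trans (∧-cong (nfNeg-correct φ) (nfNeg-correct ψ)) (≃-sym ¬-∨)
nfNeg-correct (⟨ γ ⟩ᵖ φ) = ≃-trans (⟨⟩-cong (nfGd-correct γ) (nfNeg-correct φ)) ᵈ-¬

nfG-correct (gᵖ g)   = ≋-refl
nfG-correct (γ ⨟ᵖ δ) = ⨟-cong (nfG-correct γ) (nfG-correct δ)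
nfG-correct (γ ⊔ᵖ δ) = ⊔-cong (nfG-correct γ) (nfG-correct δ)
nfG-correct (γ *ᵖ)   = *-cong (nfG-correct γ)
nfG-correct (γ ᵈᵖ)   = nfGd-correct γ
nfG-correct (φ ?ᵖ)   = ?-cong (nf-correct φ)

nfGd-correct (gᵖ g)   = ≋-refl
nfGd-correct (γ ⨟ᵖ δ) = ≋-trans (⨟-cong (nfGd-correct γ) (nfGd-correct δ)) (≋-sym ⨟-ᵈ)
nfGd-correct (γ ⊔ᵖ δ) = ≋-trans (⊓-cong (nfGd-correct γ) (nfGd-correct δ)) (≋-sym ⊔-ᵈ)
nfGd-correct (γ *ᵖ)   = ≋-trans (×-cong (nfGd-correct γ)) (≋-sym *-ᵈ)
nfGd-correct (γ ᵈᵖ)   = ≋-trans (nfG-correct γ) (≋-sym ᵈᵈ)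
nfGd-correct (φ ?ᵖ)   = ≋-trans (!-cong (nfNeg-correct φ)) (≋-sym ?-ᵈ)

-- Soundness of G

⋁ : List NFm → Fm
⋁ []      = ⊥ᵖ
⋁ (φ ∷ Φ) = par φ ∨ᵖ ⋁ Φ

∈⇒⊑⋁ : ∀ {φ Φ} → φ ∈ Φ → par φ ⊑ ⋁ Φ
∈⇒⊑⋁ (here refl) = ∨-injˡ
∈⇒⊑⋁ (there m)   = ⊑-trans (∈⇒⊑⋁ m) ∨-injʳ

⋁-⊆ : ∀ {Φ Ψ} → (∀ {φ} → φ ∈ Φ → φ ∈ Ψ) → ⋁ Φ ⊑ ⋁ Ψ
⋁-⊆ {[]}    s = ⊥ᵖ-⊑
⋁-⊆ {φ ∷ Φ} s = ∨-elim (∈⇒⊑⋁ (s (here refl))) (⋁-⊆ (λ m → s (there m)))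

compSet-correct : ∀ φ Φ → par (compSet φ Φ) ≃ ¬ᵖ ⋁ (φ ∷ Φ)
compSet-correct φ []      = ≃-trans (comp-correct φ) (¬-cong (≃-sym ∨-⊥))
compSet-correct φ (ψ ∷ Ψ) =
  ≃-trans (∧-cong (comp-correct φ) (compSet-correct ψ Ψ)) (≃-sym ¬-∨)

⟨⟩-ᵈ-∨ : Par⊢ (A ∨ᵖ B) → Par⊢ (⟨ α ⟩ᵖ A ∨ᵖ ⟨ α ᵈᵖ ⟩ᵖ B)
⟨⟩-ᵈ-∨ {α = α} h = ¬⊑⇒⊢∨ (⊑-trans (≃⇒⊑ ¬-ᵈ) (mono α (⊢∨⇒¬⊑ h)))

⋁-pair : ∀ {φ ψ} → ⋁ (φ ∷ ψ ∷ []) ≃ par φ ∨ᵖ par ψ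
⋁-pair = ∨-cong ≃-refl ∨-⊥

sound : ∀ {Φ} → G⊢ Φ → Par⊢ ⋁ Φ
sound (reorder d s)  = ⋁-⊆ (λ {φ} → Equivalence.to (s φ)) · sound d
sound (ax φ Φ _)     = ¬⊑⇒⊢∨ (≃⇒⊒ (compSet-correct φ Φ))
sound (weak d)       = ∨-injʳ · sound d
sound (modal {φ} {ψ} g d) =
  ≃⇒⊒ (⋁-pair {⟨ gⁿ g ⟩ⁿ φ} {⟨ gdⁿ g ⟩ⁿ ψ}) · ⟨⟩-ᵈ-∨ (≃⇒⊑ ⋁-pair · sound d)
sound (∨rule d)      = ∨-assoc · sound d
sound (∧rule d e)    = ⊢-∧-∨ (sound d) (sound e)
sound (*rule d)      = ⊢-∨-monoˡ (≃⇒⊒ *-≃) (sound d)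
sound (×rule d)      = ⊢-∨-monoˡ (≃⇒⊒ ×-≃) (sound d)
sound (⊔rule d)      = ⊢-∨-monoˡ (≃⇒⊒ ⊔-≃) (sound d)
sound (⊓rule d)      = ⊢-∨-monoˡ (≃⇒⊒ ⊓-≃) (sound d)
sound (?rule d)      = ⊢-∨-monoˡ (≃⇒⊒ ?-≃) (sound d)
sound (!rule d)      = ⊢-∨-monoˡ (≃⇒⊒ !-≃) (sound d)
sound (deep!G c d)   = ⊢-∨-monoˡ (plugF-mono c !⨟-intro) (sound d)
sound (deep!F c d)   = ⊢-∨-monoˡ (plugF-mono c !-intro) (sound d)
sound (deep⨟ c d)    = ⊢-∨-monoˡ (plugF-mono c (≃⇒⊒ ⨟-≃)) (sound d)
sound (×ind ψ Ψ _ d) =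
  ¬⊑⇒⊢∨ (⊑-trans (≃⇒⊒ N≃¬D) (×-coind-guarded (⊑-trans (≃⇒⊑ N≃¬D) (⊢∨⇒¬⊑ (sound d)))))
  where
  N≃¬D : par (compSet ψ Ψ) ≃ ¬ᵖ ⋁ (ψ ∷ Ψ)
  N≃¬D = compSet-correct ψ Ψ

sound-singleton : ∀ {ξ} → G⊢ (ξ ∷ []) → Par⊢ par ξ
sound-singleton d = ≃⇒⊑ ∨-⊥ · sound d

theorem3 : ((φ : Fm) → G⊢ (nf φ ∷ []) → Par⊢ φ) × ((ξ : NFm) → G⊢ (ξ ∷ []) → Par⊢ par ξ)
theorem3 = (λ φ d → ≃⇒⊑ (nf-correct φ) · sound-singleton d)
         , (λ ξ → sound-singleton)
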